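{- Let $a,b$ be odd positive integers. For every positive integer $n$, $$t(a,3a,2b;n)=\frac 23N(a,3a,2b;8n+4a+2b).$$
   Context: For positive integers $a_1,\dots,a_k$ and a nonnegative integer $n$, $N(a_1,\dots,a_k;n)$ is the number of $(x_1,\dots,x_k)\in\mathbb Z^k$ with $n=a_1x_1^2+\cdots+a_kx_k^2$, and $t(a_1,\dots,a_k;n)$ is the number of $(x_1,\dots,x_k)\in\mathbb Z^k$ with $n=a_1\frac{x_1(x_1-1)}2+\cdots+a_k\frac{x_k(x_k-1)}2$. -}

module Defs where

open import Data.Nat using (ℕ; zero; suc)
open import Data.Integer using (ℤ; +_; _+_; _-_; _*_; -_)
open import Data.Integer.Properties using (_≟_)
open import Data.List using (List; []; _∷_; map)
open import Data.Nat.ListAction using (sum)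
open import Relation.Nullary using (yes; no)

range : ℕ → List ℤ
range zero    = + 0 ∷ []
range (suc B) = (- (+ suc B)) ∷ (+ suc B) ∷ range B

-- cnt f B as t = #{ (x₁,…,x_k) ∈ [-B,B]^k : a₁ f(x₁) + ⋯ + a_k f(x_k) = t }
-- where as = a₁ ∷ ⋯ ∷ a_k ∷ []
cnt : (ℤ → ℤ) → ℕ → List ℕ → ℤ → ℕ
cnt f B []       t with t ≟ + 0
... | yes _ = 1
... | no  _ = 0
cnt f B (a ∷ as) t = sum (map (λ x → cnt f B as (t - (+ a) * f x)) (range B))

sq : ℤ → ℤ
sq x = x * x

twoTri : ℤ → ℤ
twoTri x = x * (x - + 1)

-- N(a₁,…,a_k; n): number of (x₁,…,x_k) ∈ ℤ^k with n = Σ aᵢ xᵢ².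
-- For positive aᵢ every solution has |xᵢ| ≤ n, so the box [-n,n]^k is exhaustive.
N : List ℕ → ℕ → ℕ
N as n = cnt sq n as (+ n)

-- t(a₁,…,a_k; n): number of (x₁,…,x_k) ∈ ℤ^k with n = Σ aᵢ xᵢ(xᵢ-1)/2,
-- i.e. 2n = Σ aᵢ xᵢ(xᵢ-1).  For positive aᵢ every solution has |xᵢ| ≤ n+1.
t : List ℕ → ℕ → ℕ
t as n = cnt twoTri (suc n) as (+ (2 Data.Nat.* n))

module Submission where

-- Put m = 8n + 4a + 2b. As a and b are odd, a solution of a X² + 3a Y² + 2b Z² = m has X, Y, Z all odd,
-- or X, Y even and Z odd with X/2 + Y/2 odd: every other parity pattern makes m − a X² − 3a Y² − 2b Z²
-- an odd number times 1, 2 or 4. Since (2x − 1)² = 4x(x − 1) + 1, the map x ↦ 2x − 1 identifies the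
-- solutions counted by t(a, 3a, 2b; n) with the all-odd solutions. These split into those with
-- Y ≡ X and those with Y ≡ X + 2 (mod 4), which Y ↦ −Y exchanges, and (2u, 2w, Z) ↦ (u − 3w, u + w, Z)
-- maps the remaining solutions bijectively onto the first kind, as a(u − 3w)² + 3a(u + w)² = a(2u)² + 3a(2w)².
-- So t = 2S and N = 3S for a single count S.

open import Defs

module Representations where

  open import Data.Bool using (Bool; true; false; not; _∧_; _xor_; if_then_else_)
  import Data.Bool.Properties as Bool
  open import Data.Empty using (⊥-elim)
  open import Data.Integer as ℤ using (ℤ; +_; -[1+_]; +[1+_]; ∣_∣; _+_; _-_; _*_; -_)
  import Data.Integer.Divisibility.Signed as Signed
  import Data.Integer.Properties as ℤ
  open import Data.Integer.Tactic.RingSolver using (solve-∀)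
  open import Data.List using (List; []; _∷_; _++_; map; filter; cartesianProduct)
  open import Data.List.Membership.Propositional using (_∈_)
  open import Data.List.Membership.Propositional.Properties
    using (∈-map⁺; ∈-map⁻; ∈-filter⁺; ∈-filter⁻; ∈-cartesianProduct⁺)
  open import Data.List.Membership.Propositional.Properties.WithK using (unique∧set⇒bag)
  open import Data.List.Properties using (map-++; map-∘; map-cong; map-cong-local; map-id)
  open import Data.List.Relation.Binary.BagAndSetEquality using (∼bag⇒↭; _∼[_]_; bag)
  import Data.List.Relation.Binary.Permutation.Propositional.Properties as Perm
  open import Data.List.Relation.Unary.All as All using (All)
  open import Data.List.Relation.Unary.All.Properties using (all-filter)
  import Data.List.Relation.Unary.AllPairs as AllPairs
  open import Data.List.Relation.Unary.Any using (here; there)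
  open import Data.List.Relation.Unary.Unique.Propositional using (Unique)
  import Data.List.Relation.Unary.Unique.Propositional.Properties as Unique
  open import Data.Nat as ℕ using (ℕ; zero; suc; _≤_; z≤n; s≤s; NonZero)
  open import Data.Nat.Divisibility using () renaming (∣1⇒≡1 to ℕ∣1⇒≡1)
  import Data.Nat.DivMod as ℕ
  open import Data.Nat.ListAction using (sum)
  open import Data.Nat.ListAction.Properties using (sum-++; sum-↭)
  import Data.Nat.Properties as ℕ
  import Data.Nat.Tactic.RingSolver as ℕ-Solver
  open import Data.Product using (_×_; _,_; proj₁; proj₂)
  open import Function using (_∘_; case_of_)
  open import Function.Bundles using (mk⇔)
  open import Relation.Binary.PropositionalEquality
  open import Relation.Nullary using (yes; no)

  -- Weighted sums over finite lists

  module _ {A : Set} where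

    support : (A → ℕ) → List A → List A
    support h = filter (ℕ.nonZero? ∘ h)

    sum-support : ∀ h xs → sum (map h xs) ≡ sum (map h (support h xs))
    sum-support h [] = refl
    sum-support h (x ∷ xs) with h x in hx
    ... | zero  = sum-support h xs
    ... | suc _ = cong₂ ℕ._+_ (sym hx) (sum-support h xs)

    sum-map-+ : ∀ (h k : A → ℕ) xs →
                sum (map (λ x → h x ℕ.+ k x) xs) ≡ sum (map h xs) ℕ.+ sum (map k xs)
    sum-map-+ h k [] = refl
    sum-map-+ h k (x ∷ xs) = trans (cong (h x ℕ.+ k x ℕ.+_) (sum-map-+ h k xs)) (interchange (h x) (k x) _ _)
      where
      interchange : ∀ p q r s → p ℕ.+ q ℕ.+ (r ℕ.+ s) ≡ p ℕ.+ r ℕ.+ (q ℕ.+ s)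
      interchange = ℕ-Solver.solve-∀

    restrict : (A → Bool) → (A → ℕ) → A → ℕ
    restrict P h x = if P x then h x else 0

    restrict-cong : ∀ P h x P′ h′ x′ → P x ≡ P′ x′ → h x ≡ h′ x′ →
      restrict P h x ≡ restrict P′ h′ x′
    restrict-cong _ _ _ _ _ _ = cong₂ (λ b k → if b then k else 0)

    restrict-true : ∀ P h x → P x ≡ true → restrict P h x ≡ h x
    restrict-true P h x = cong (λ b → if b then h x else 0)

    restrict-nonZero : ∀ P h x → NonZero (restrict P h x) → P x ≡ true × NonZero (h x)
    restrict-nonZero P h x nz with P x
    ... | true = refl , nz

    restrict-support : ∀ P {h xs} → (∀ x → NonZero (h x) → x ∈ xs) →
      ∀ x → NonZero (restrict P h x) → x ∈ xs
    restrict-support P {h} h⊆xs x = h⊆xs x ∘ proj₂ ∘ restrict-nonZero P h x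

    sum-restrict : ∀ P h xs →
      sum (map h xs) ≡ sum (map (restrict P h) xs) ℕ.+ sum (map (restrict (not ∘ P) h) xs)
    sum-restrict P h xs = trans (cong sum (map-cong split xs)) (sum-map-+ (restrict P h) (restrict (not ∘ P) h) xs)
      where
      split : ∀ x → h x ≡ restrict P h x ℕ.+ restrict (not ∘ P) h x
      split x with P x
      ... | true  = sym (ℕ.+-identityʳ (h x))
      ... | false = refl

  module _ {A B : Set} where

    sum-cartesianProduct : ∀ (h : A × B → ℕ) xs ys →
      sum (map h (cartesianProduct xs ys)) ≡ sum (map (λ x → sum (map (λ y → h (x , y)) ys)) xs)
    sum-cartesianProduct h [] ys = refl
    sum-cartesianProduct h (x ∷ xs) ys = begin
      sum (map h (map (x ,_) ys ++ cartesianProduct xs ys))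
        ≡⟨ cong sum (map-++ h (map (x ,_) ys) _) ⟩
      sum (map h (map (x ,_) ys) ++ map h (cartesianProduct xs ys))
        ≡⟨ sum-++ (map h (map (x ,_) ys)) _ ⟩
      sum (map h (map (x ,_) ys)) ℕ.+ sum (map h (cartesianProduct xs ys))
        ≡⟨ cong₂ ℕ._+_ (cong sum (sym (map-∘ ys))) (sum-cartesianProduct h xs ys) ⟩
      sum (map (λ y → h (x , y)) ys) ℕ.+ sum (map (λ x → sum (map (λ y → h (x , y)) ys)) xs) ∎
      where open ≡-Reasoning

    sum-reindex : ∀ {xs ys} (h : A → ℕ) (k : B → ℕ) (f : A → B) (g : B → A) →
      Unique xs → Unique ys →
      (∀ x → NonZero (h x) → x ∈ xs) → (∀ y → NonZero (k y) → y ∈ ys) →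
      (∀ x → NonZero (h x) → g (f x) ≡ x × k (f x) ≡ h x) →
      (∀ y → NonZero (k y) → f (g y) ≡ y × h (g y) ≡ k y) →
      sum (map h xs) ≡ sum (map k ys)
    sum-reindex {xs} {ys} h k f g xs! ys! h⊆xs k⊆ys gf fg = begin
      sum (map h xs)             ≡⟨ sum-support h xs ⟩
      sum (map h S)              ≡⟨ cong sum (map-cong-local (All.map (sym ∘ proj₂ ∘ gf _) S≠0)) ⟩
      sum (map (k ∘ f) S)        ≡⟨ cong sum (map-∘ S) ⟩
      sum (map k (map f S))      ≡⟨ sum-↭ (Perm.map⁺ k (∼bag⇒↭ fS∼T)) ⟩
      sum (map k T)              ≡⟨ sum-support k ys ⟨
      sum (map k ys)             ∎
      where
      open ≡-Reasoning
      S : List A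
      S = support h xs
      T : List B
      T = support k ys
      S≠0 : All (λ x → NonZero (h x)) S
      S≠0 = all-filter _ xs
      g∘f≡id : map g (map f S) ≡ S
      g∘f≡id = trans (sym (map-∘ S)) (trans (map-cong-local (All.map (proj₁ ∘ gf _) S≠0)) (map-id S))
      fS! : Unique (map f S)
      fS! = Unique.map⁻ (subst Unique (sym g∘f≡id) (Unique.filter⁺ _ xs!))
      T! : Unique T
      T! = Unique.filter⁺ _ ys!
      to : ∀ {y} → y ∈ map f S → y ∈ T
      to y∈fS with x , x∈S , refl ← ∈-map⁻ f y∈fS =
        let x∈xs , hx≠0 = ∈-filter⁻ (ℕ.nonZero? ∘ h) {xs = xs} x∈S
            kfx≠0 = subst NonZero (sym (proj₂ (gf x hx≠0))) hx≠0
        in ∈-filter⁺ (ℕ.nonZero? ∘ k) (k⊆ys (f x) kfx≠0) kfx≠0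
      from : ∀ {y} → y ∈ T → y ∈ map f S
      from {y} y∈T =
        let y∈ys , ky≠0 = ∈-filter⁻ (ℕ.nonZero? ∘ k) {xs = ys} y∈T
            f∘g≡id , hgy≡ky = fg y ky≠0
            hgy≠0 = subst NonZero (sym hgy≡ky) ky≠0
        in subst (_∈ map f S) f∘g≡id (∈-map⁺ f (∈-filter⁺ (ℕ.nonZero? ∘ h) (h⊆xs (g y) hgy≠0) hgy≠0))
      fS∼T : map f S ∼[ bag ] T
      fS∼T = unique∧set⇒bag fS! T! (mk⇔ to from)

  -- Counting solutions in a box

  ℤ³ : Set
  ℤ³ = ℤ × ℤ × ℤ

  δ : ℤ → ℕ
  δ (+ zero)  = 1
  δ +[1+ _ ]  = 0
  δ -[1+ _ ]  = 0

  cnt-[] : ∀ f B u → cnt f B [] u ≡ δ u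
  cnt-[] f B u with u ℤ.≟ + 0
  cnt-[] f B .(+ 0) | yes refl = refl
  cnt-[] f B (+ zero)   | no u≢0 = ⊥-elim (u≢0 refl)
  cnt-[] f B +[1+ _ ]   | no _   = refl
  cnt-[] f B -[1+ _ ]   | no _   = refl

  δ-nonZero : ∀ u → NonZero (δ u) → u ≡ + 0
  δ-nonZero (+ zero) _ = refl

  δ-4* : ∀ u → δ (+ 4 * u) ≡ δ u
  δ-4* (+ zero)  = refl
  δ-4* +[1+ _ ]  = refl
  δ-4* -[1+ _ ]  = refl

  ∈-range⁻ : ∀ B {x} → x ∈ range B → ∣ x ∣ ≤ B
  ∈-range⁻ zero    (here refl)         = z≤n
  ∈-range⁻ (suc B) (here refl)         = ℕ.≤-refl
  ∈-range⁻ (suc B) (there (here refl)) = ℕ.≤-refl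
  ∈-range⁻ (suc B) (there (there x∈))  = ℕ.m≤n⇒m≤1+n (∈-range⁻ B x∈)

  ∈-range⁺ : ∀ B {x} → ∣ x ∣ ≤ B → x ∈ range B
  ∈-range⁺ zero    {x} |x|≤0 = here (ℤ.∣i∣≡0⇒i≡0 (ℕ.n≤0⇒n≡0 |x|≤0))
  ∈-range⁺ (suc B) {x} |x|≤1+B with ∣ x ∣ ℕ.≟ suc B
  ∈-range⁺ (suc B) {+[1+ .B ]} _ | yes refl = there (here refl)
  ∈-range⁺ (suc B) { -[1+ .B ]} _ | yes refl = here refl
  ... | no |x|≢1+B = there (there (∈-range⁺ B (ℕ.≤-pred (ℕ.≤∧≢⇒< |x|≤1+B |x|≢1+B))))

  range-unique : ∀ B → Unique (range B)
  range-unique zero    = All.[] AllPairs.∷ AllPairs.[]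
  range-unique (suc B) = ((λ ()) All.∷ differ refl) AllPairs.∷ differ refl AllPairs.∷ range-unique B
    where
    differ : ∀ {x} → ∣ x ∣ ≡ suc B → All (x ≢_) (range B)
    differ |x|≡1+B = All.tabulate λ y∈ x≡y →
      ℕ.<-irrefl refl (subst (_≤ B) (trans (cong ∣_∣ (sym x≡y)) |x|≡1+B) (∈-range⁻ B y∈))

  box : ℕ → List ℤ³
  box B = cartesianProduct (range B) (cartesianProduct (range B) (range B))

  box-unique : ∀ B → Unique (box B)
  box-unique B =
    Unique.cartesianProduct⁺ (range-unique B) (Unique.cartesianProduct⁺ (range-unique B) (range-unique B))

  ∈-box⁺ : ∀ B {x y z} → ∣ x ∣ ≤ B → ∣ y ∣ ≤ B → ∣ z ∣ ≤ B → (x , y , z) ∈ box B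
  ∈-box⁺ B |x|≤B |y|≤B |z|≤B =
    ∈-cartesianProduct⁺ (∈-range⁺ B |x|≤B)
      (∈-cartesianProduct⁺ (∈-range⁺ B |y|≤B) (∈-range⁺ B |z|≤B))

  form : (ℤ → ℤ) → ℤ → ℤ → ℤ → ℤ³ → ℤ
  form f a b c (x , y , z) = a * f x + b * f y + c * f z

  cnt-box : ∀ f B a b c t →
    cnt f B (a ∷ b ∷ c ∷ []) t ≡ sum (map (λ v → δ (t - form f (+ a) (+ b) (+ c) v)) (box B))
  cnt-box f B a b c t = sym (begin
    sum (map weight (box B))
      ≡⟨ sum-cartesianProduct weight R (cartesianProduct R R) ⟩
    sum (map (λ x → sum (map (λ yz → weight (x , yz)) (cartesianProduct R R))) R)
      ≡⟨ cong sum (map-cong (λ x → sum-cartesianProduct (λ yz → weight (x , yz)) R R) R) ⟩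
    sum (map (λ x → sum (map (λ y → sum (map (λ z → weight (x , y , z)) R)) R)) R)
      ≡⟨ cong sum (map-cong (λ x → cong sum (map-cong (λ y → cong sum (map-cong (weight≡cnt x y) R)) R)) R) ⟩
    cnt f B (a ∷ b ∷ c ∷ []) t ∎)
    where
    open ≡-Reasoning
    R : List ℤ
    R = range B
    weight : ℤ³ → ℕ
    weight v = δ (t - form f (+ a) (+ b) (+ c) v)
    regroup : ∀ t p q r → t - (p + q + r) ≡ ((t - p) - q) - r
    regroup = solve-∀
    weight≡cnt : ∀ x y z → weight (x , y , z) ≡ cnt f B [] (((t - + a * f x) - + b * f y) - + c * f z)
    weight≡cnt x y z = trans (cong δ (regroup t (+ a * f x) (+ b * f y) (+ c * f z))) (sym (cnt-[] f B _))

  module _ {f : ℤ → ℤ} {F : ℤ → ℕ} (f≡F : ∀ x → f x ≡ + F x) where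

    form≡+ : ∀ a b c x y z →
      form f (+ a) (+ b) (+ c) (x , y , z) ≡ + (a ℕ.* F x ℕ.+ b ℕ.* F y ℕ.+ c ℕ.* F z)
    form≡+ a b c x y z = begin
      + a * f x + + b * f y + + c * f z
        ≡⟨ cong₂ _+_ (cong₂ _+_ (cong (+ a *_) (f≡F x)) (cong (+ b *_) (f≡F y))) (cong (+ c *_) (f≡F z)) ⟩
      + a * + F x + + b * + F y + + c * + F z
        ≡⟨ cong₂ _+_ (cong₂ _+_ (ℤ.pos-* a (F x)) (ℤ.pos-* b (F y))) (ℤ.pos-* c (F z)) ⟨
      + (a ℕ.* F x) + + (b ℕ.* F y) + + (c ℕ.* F z)
        ≡⟨ cong (_+ + (c ℕ.* F z)) (ℤ.pos-+ (a ℕ.* F x) (b ℕ.* F y)) ⟨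
      + (a ℕ.* F x ℕ.+ b ℕ.* F y) + + (c ℕ.* F z)
        ≡⟨ ℤ.pos-+ (a ℕ.* F x ℕ.+ b ℕ.* F y) (c ℕ.* F z) ⟨
      + (a ℕ.* F x ℕ.+ b ℕ.* F y ℕ.+ c ℕ.* F z) ∎
      where open ≡-Reasoning

    solution∈box : ∀ {B M} → (∀ x → F x ≤ M → ∣ x ∣ ≤ B) →
      ∀ a b c .{{_ : NonZero a}} .{{_ : NonZero b}} .{{_ : NonZero c}} v →
      form f (+ a) (+ b) (+ c) v ≡ + M → v ∈ box B
    solution∈box {B} {M} bound a b c (x , y , z) fv≡M =
      ∈-box⁺ B (bound x Fx≤M) (bound y Fy≤M) (bound z Fz≤M)
      where
      M≡ : a ℕ.* F x ℕ.+ b ℕ.* F y ℕ.+ c ℕ.* F z ≡ M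
      M≡ = ℤ.+-injective (trans (sym (form≡+ a b c x y z)) fv≡M)
      Fx≤M : F x ≤ M
      Fx≤M = ℕ.≤-trans (ℕ.m≤n*m (F x) a) (subst (_ ≤_) M≡ (ℕ.≤-trans (ℕ.m≤m+n _ _) (ℕ.m≤m+n _ _)))
      Fy≤M : F y ≤ M
      Fy≤M = ℕ.≤-trans (ℕ.m≤n*m (F y) b)
        (subst (_ ≤_) M≡ (ℕ.≤-trans (ℕ.m≤n+m (b ℕ.* F y) (a ℕ.* F x)) (ℕ.m≤m+n _ _)))
      Fz≤M : F z ≤ M
      Fz≤M = ℕ.≤-trans (ℕ.m≤n*m (F z) c) (subst (_ ≤_) M≡ (ℕ.m≤n+m _ _))

  sq≡∣∣² : ∀ x → sq x ≡ + (∣ x ∣ ℕ.* ∣ x ∣)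
  sq≡∣∣² (+ k)    = sym (ℤ.pos-* k k)
  sq≡∣∣² -[1+ k ] = refl

  ∣∣²-bound : ∀ {M} x → ∣ x ∣ ℕ.* ∣ x ∣ ≤ M → ∣ x ∣ ≤ M
  ∣∣²-bound (+ zero) _ = z≤n
  ∣∣²-bound +[1+ k ] k²≤M = ℕ.≤-trans (ℕ.m≤m*n (suc k) (suc k)) k²≤M
  ∣∣²-bound -[1+ k ] k²≤M = ℕ.≤-trans (ℕ.m≤m*n (suc k) (suc k)) k²≤M

  twoTriℕ : ℤ → ℕ
  twoTriℕ (+ zero)  = 0
  twoTriℕ +[1+ k ]  = suc k ℕ.* k
  twoTriℕ -[1+ k ]  = suc k ℕ.* suc (suc k)

  twoTri≡twoTriℕ : ∀ x → twoTri x ≡ + twoTriℕ x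
  twoTri≡twoTriℕ (+ zero)  = refl
  twoTri≡twoTriℕ +[1+ k ]  = trans (cong (+[1+ k ] *_) (pred-suc (+ k))) (sym (ℤ.pos-* (suc k) k))
    where
    pred-suc : ∀ i → (+ 1 + i) - + 1 ≡ i
    pred-suc = solve-∀
  twoTri≡twoTriℕ -[1+ k ]  = trans (neg-pred (+ k)) (sym (ℤ.pos-* (suc k) (suc (suc k))))
    where
    neg-pred : ∀ i → (- (+ 1 + i)) * ((- (+ 1 + i)) - + 1) ≡ (+ 1 + i) * (+ 2 + i)
    neg-pred = solve-∀

  twoTriℕ-bound : ∀ {n} x → twoTriℕ x ≤ 2 ℕ.* n → ∣ x ∣ ≤ suc n
  twoTriℕ-bound (+ zero)        _ = z≤n
  twoTriℕ-bound +[1+ zero ]     _ = s≤s z≤n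
  twoTriℕ-bound +[1+ suc j ]    T≤2n =
    s≤s (ℕ.*-cancelˡ-≤ 2 (ℕ.≤-trans (ℕ.*-monoˡ-≤ (suc j) {2} {suc (suc j)} (s≤s (s≤s z≤n))) T≤2n))
  twoTriℕ-bound -[1+ k ]        T≤2n = ℕ.m≤n⇒m≤1+n
    (ℕ.*-cancelˡ-≤ 2 (ℕ.≤-trans (ℕ.≤-reflexive (ℕ.*-comm 2 (suc k)))
      (ℕ.≤-trans (ℕ.*-monoʳ-≤ (suc k) (s≤s (s≤s z≤n))) T≤2n)))

  -- Parity of integers

  bit : Bool → ℤ
  bit false = + 0
  bit true  = + 1

  oddℕ? : ℕ → Bool
  oddℕ? zero          = false
  oddℕ? (suc zero)    = true
  oddℕ? (suc (suc k)) = oddℕ? k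

  -- Rounds down, also for negative arguments.
  half : ℤ → ℤ
  half (+ k)     = + ℕ.⌊ k /2⌋
  half -[1+ k ]  = -[1+ ℕ.⌊ k /2⌋ ]

  odd? : ℤ → Bool
  odd? (+ k)     = oddℕ? k
  odd? -[1+ k ]  = not (oddℕ? k)

  half-odd?-decomposition : ∀ x → x ≡ + 2 * half x + bit (odd? x)
  half-odd?-decomposition (+ k)    = decompositionℕ k
    where
    decompositionℕ : ∀ k → + k ≡ + 2 * + ℕ.⌊ k /2⌋ + bit (oddℕ? k)
    decompositionℕ zero          = refl
    decompositionℕ (suc zero)    = refl
    decompositionℕ (suc (suc k)) =
      trans (cong (_+_ (+ 2)) (decompositionℕ k)) (shift (+ ℕ.⌊ k /2⌋) (bit (oddℕ? k)))
      where
      shift : ∀ h b → + 2 + (+ 2 * h + b) ≡ + 2 * (+ 1 + h) + b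
      shift = solve-∀
  half-odd?-decomposition -[1+ k ] =
    trans (cong (λ k′ → - (+ 1 + k′)) (half-odd?-decomposition (+ k))) (negate (+ ℕ.⌊ k /2⌋) (oddℕ? k))
    where
    flip : ∀ h b → - (+ 1 + (+ 2 * h + b)) ≡ + 2 * - (+ 1 + h) + (+ 1 - b)
    flip = solve-∀
    negate : ∀ h r → - (+ 1 + (+ 2 * h + bit r)) ≡ + 2 * - (+ 1 + h) + bit (not r)
    negate h false = flip h (+ 0)
    negate h true  = flip h (+ 1)

  1+2*≢0 : ∀ w → + 1 + + 2 * w ≢ + 0
  1+2*≢0 w 1+2w≡0 with ℕ∣1⇒≡1 (Signed.∣⇒∣ᵤ (Signed.divides (- w) 1≡-w*2))
    where
    1≡-w*2 : + 1 ≡ - w * + 2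
    1≡-w*2 = trans (split w) (trans (cong (_+ - w * + 2) 1+2w≡0) (ℤ.+-identityˡ _))
      where
      split : ∀ w → + 1 ≡ (+ 1 + + 2 * w) + - w * + 2
      split = solve-∀
  ... | ()

  2*+-cancelʳ : ∀ {h k} b → + 2 * h + b ≡ + 2 * k + b → h ≡ k
  2*+-cancelʳ {h} {k} b eq =
    ℤ.i-j≡0⇒i≡j h k (ℤ.*-cancelˡ-≡ (+ 2) (h - k) (+ 0) (trans (rearrange h k b) (ℤ.i≡j⇒i-j≡0 eq)))
    where
    rearrange : ∀ h k b → + 2 * (h - k) ≡ (+ 2 * h + b) - (+ 2 * k + b)
    rearrange = solve-∀

  2*+1≢2*+0 : ∀ h k → + 2 * h + + 1 ≢ + 2 * k + + 0
  2*+1≢2*+0 h k eq = 1+2*≢0 (h - k) (trans (rearrange h k) (ℤ.i≡j⇒i-j≡0 eq))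
    where
    rearrange : ∀ h k → + 1 + + 2 * (h - k) ≡ (+ 2 * h + + 1) - (+ 2 * k + + 0)
    rearrange = solve-∀

  2*+bit-injective : ∀ {h k r s} → + 2 * h + bit r ≡ + 2 * k + bit s → h ≡ k × r ≡ s
  2*+bit-injective {r = false} {false} eq = 2*+-cancelʳ (+ 0) eq , refl
  2*+bit-injective {r = true}  {true}  eq = 2*+-cancelʳ (+ 1) eq , refl
  2*+bit-injective {h} {k} {true}  {false} eq = ⊥-elim (2*+1≢2*+0 h k eq)
  2*+bit-injective {h} {k} {false} {true}  eq = ⊥-elim (2*+1≢2*+0 k h (sym eq))

  half-odd?-unique : ∀ {x} k r → x ≡ + 2 * k + bit r → half x ≡ k × odd? x ≡ r
  half-odd?-unique {x} k r x≡2k+r = 2*+bit-injective (trans (sym (half-odd?-decomposition x)) x≡2k+r)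

  odd⇒≡2*half+1 : ∀ x → odd? x ≡ true → x ≡ + 2 * half x + + 1
  odd⇒≡2*half+1 x odd = trans (half-odd?-decomposition x) (cong (λ r → + 2 * half x + bit r) odd)

  even⇒≡2*half : ∀ x → odd? x ≡ false → x ≡ + 2 * half x
  even⇒≡2*half x even =
    trans (half-odd?-decomposition x) (trans (cong (λ r → + 2 * half x + bit r) even) (ℤ.+-identityʳ _))

  half-2* : ∀ k → half (+ 2 * k) ≡ k
  half-2* k = proj₁ (half-odd?-unique k false (sym (ℤ.+-identityʳ (+ 2 * k))))

  odd?-2* : ∀ k → odd? (+ 2 * k) ≡ false
  odd?-2* k = proj₂ (half-odd?-unique k false (sym (ℤ.+-identityʳ (+ 2 * k))))

  odd?-+ : ∀ x y → odd? (x + y) ≡ odd? x xor odd? y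
  odd?-+ x y = proj₂ (half-odd?-unique (half x + half y + bit (odd? x ∧ odd? y)) (odd? x xor odd? y) (begin
    x + y
      ≡⟨ cong₂ _+_ (half-odd?-decomposition x) (half-odd?-decomposition y) ⟩
    (+ 2 * half x + bit (odd? x)) + (+ 2 * half y + bit (odd? y))
      ≡⟨ regroup (half x) (half y) (bit (odd? x)) (bit (odd? y)) ⟩
    + 2 * (half x + half y) + (bit (odd? x) + bit (odd? y))
      ≡⟨ cong (_+_ (+ 2 * (half x + half y))) (bit+bit (odd? x) (odd? y)) ⟩
    + 2 * (half x + half y) + (+ 2 * bit (odd? x ∧ odd? y) + bit (odd? x xor odd? y))
      ≡⟨ regroup′ (half x + half y) (bit (odd? x ∧ odd? y)) (bit (odd? x xor odd? y)) ⟩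
    + 2 * (half x + half y + bit (odd? x ∧ odd? y)) + bit (odd? x xor odd? y) ∎))
    where
    open ≡-Reasoning
    regroup : ∀ h k b c → (+ 2 * h + b) + (+ 2 * k + c) ≡ + 2 * (h + k) + (b + c)
    regroup = solve-∀
    regroup′ : ∀ h c d → + 2 * h + (+ 2 * c + d) ≡ + 2 * (h + c) + d
    regroup′ = solve-∀
    bit+bit : ∀ r s → bit r + bit s ≡ + 2 * bit (r ∧ s) + bit (r xor s)
    bit+bit false false = refl
    bit+bit false true  = refl
    bit+bit true  false = refl
    bit+bit true  true  = refl

  odd?-+-2* : ∀ x k → odd? (x + + 2 * k) ≡ odd? x
  odd?-+-2* x k = trans (odd?-+ x (+ 2 * k)) (trans (cong (odd? x xor_) (odd?-2* k)) (Bool.xor-identityʳ (odd? x)))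

  odd?-neg : ∀ x → odd? (- x) ≡ odd? x
  odd?-neg x = proj₂ (half-odd?-unique (- half x - bit (odd? x)) (odd? x)
    (trans (cong -_ (half-odd?-decomposition x)) (negate (half x) (bit (odd? x)))))
    where
    negate : ∀ h b → - (+ 2 * h + b) ≡ + 2 * (- h - b) + b
    negate = solve-∀

  odd⇒≢0 : ∀ {x} → odd? x ≡ true → x ≢ + 0
  odd⇒≢0 odd refl = case odd of λ ()

  odd+2*≢0 : ∀ {x} w → odd? x ≡ true → x + + 2 * w ≢ + 0
  odd+2*≢0 {x} w odd = odd⇒≢0 (trans (odd?-+-2* x w) odd)

  odd-nonZero : ∀ k → odd? (+ k) ≡ true → NonZero k
  odd-nonZero (suc k) _ = _

  %2≡1⇒odd? : ∀ k → k ℕ.% 2 ≡ 1 → odd? (+ k) ≡ true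
  %2≡1⇒odd? k k%2≡1 = proj₂ (half-odd?-unique (+ (k ℕ./ 2)) true (begin
    + k                      ≡⟨ cong +_ (trans (ℕ.m≡m%n+[m/n]*n k 2) (cong (ℕ._+ k ℕ./ 2 ℕ.* 2) k%2≡1)) ⟩
    + 1 + + (k ℕ./ 2 ℕ.* 2)  ≡⟨ cong (_+_ (+ 1)) (ℤ.pos-* (k ℕ./ 2) 2) ⟩
    + 1 + + (k ℕ./ 2) * + 2  ≡⟨ commute (+ (k ℕ./ 2)) ⟩
    + 2 * + (k ℕ./ 2) + + 1  ∎))
    where
    open ≡-Reasoning
    commute : ∀ q → + 1 + q * + 2 ≡ + 2 * q + + 1
    commute = solve-∀

  not≡true⇒≡false : ∀ {r} → not r ≡ true → r ≡ false
  not≡true⇒≡false {false} _ = refl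

  -- Parity classes of triples and the maps between them

  allOdd : ℤ³ → Bool
  allOdd (X , Y , Z) = odd? X ∧ odd? Y ∧ odd? Z

  allOdd⇒ : ∀ X Y Z → allOdd (X , Y , Z) ≡ true → odd? X ≡ true × odd? Y ≡ true × odd? Z ≡ true
  allOdd⇒ X Y Z odd with odd? X | odd? Y | odd? Z
  ... | true | true | true = refl , refl , refl

  -- Tests Y ≡ X (mod 4) when Y − X is even, in particular when X and Y are odd.
  congruentMod4? : ℤ³ → Bool
  congruentMod4? (X , Y , Z) = not (odd? (half (Y - X)))

  toOdd : ℤ³ → ℤ³
  toOdd (x , y , z) = (+ 2 * x - + 1 , + 2 * y - + 1 , + 2 * z - + 1)

  fromOdd : ℤ³ → ℤ³
  fromOdd (X , Y , Z) = (half X + + 1 , half Y + + 1 , half Z + + 1)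

  half-odd?-2*-1 : ∀ x → half (+ 2 * x - + 1) ≡ x - + 1 × odd? (+ 2 * x - + 1) ≡ true
  half-odd?-2*-1 x = half-odd?-unique (x - + 1) true (shift x)
    where
    shift : ∀ x → + 2 * x - + 1 ≡ + 2 * (x - + 1) + + 1
    shift = solve-∀

  allOdd-toOdd : ∀ v → allOdd (toOdd v) ≡ true
  allOdd-toOdd (x , y , z)
    rewrite proj₂ (half-odd?-2*-1 x) | proj₂ (half-odd?-2*-1 y) | proj₂ (half-odd?-2*-1 z) = refl

  fromOdd-toOdd : ∀ v → fromOdd (toOdd v) ≡ v
  fromOdd-toOdd (x , y , z) = cong₂ _,_ (inverse x) (cong₂ _,_ (inverse y) (inverse z))
    where
    cancel : ∀ x → x - + 1 + + 1 ≡ x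
    cancel = solve-∀
    inverse : ∀ x → half (+ 2 * x - + 1) + + 1 ≡ x
    inverse x = trans (cong (_+ + 1) (proj₁ (half-odd?-2*-1 x))) (cancel x)

  toOdd-fromOdd : ∀ v → allOdd v ≡ true → toOdd (fromOdd v) ≡ v
  toOdd-fromOdd (X , Y , Z) odd = let oX , oY , oZ = allOdd⇒ X Y Z odd in
    cong₂ _,_ (inverse X oX) (cong₂ _,_ (inverse Y oY) (inverse Z oZ))
    where
    cancel : ∀ h → + 2 * (h + + 1) - + 1 ≡ + 2 * h + + 1
    cancel = solve-∀
    inverse : ∀ X → odd? X ≡ true → + 2 * (half X + + 1) - + 1 ≡ X
    inverse X oX = trans (cancel (half X)) (sym (odd⇒≡2*half+1 X oX))

  rotate : ℤ³ → ℤ³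
  rotate (X , Y , Z) = (half X - + 3 * half Y , half X + half Y , Z)

  unrotate : ℤ³ → ℤ³
  unrotate (X , Y , Z) = let q = half (half (Y - X)) in (+ 2 * (Y - q) , + 2 * q , Z)

  half-rotated-difference : ∀ u w → half ((u + w) - (u - + 3 * w)) ≡ + 2 * w
  half-rotated-difference u w = trans (cong half (difference u w)) (half-2* (+ 2 * w))
    where
    difference : ∀ u w → (u + w) - (u - + 3 * w) ≡ + 2 * (+ 2 * w)
    difference = solve-∀

  rotate-class : ∀ X Y Z → odd? Z ≡ true → odd? (half X + half Y) ≡ true →
    allOdd (rotate (X , Y , Z)) ≡ true × congruentMod4? (rotate (X , Y , Z)) ≡ true
  rotate-class X Y Z oZ oXY =
    allOdd-rotate , cong not (trans (cong odd? (half-rotated-difference u w)) (odd?-2* w))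
    where
    u w : ℤ
    u = half X
    w = half Y
    shift : ∀ u w → u - + 3 * w ≡ (u + w) + + 2 * (- (+ 2 * w))
    shift = solve-∀
    odd-u-3w : odd? (u - + 3 * w) ≡ true
    odd-u-3w = trans (cong odd? (shift u w)) (trans (odd?-+-2* (u + w) _) oXY)
    allOdd-rotate : allOdd (rotate (X , Y , Z)) ≡ true
    allOdd-rotate rewrite odd-u-3w | oXY | oZ = refl

  unrotate-rotate : ∀ X Y Z → odd? X ≡ false → odd? Y ≡ false → unrotate (rotate (X , Y , Z)) ≡ (X , Y , Z)
  unrotate-rotate X Y Z oX oY = begin
    unrotate (rotate (X , Y , Z))
      ≡⟨ cong (λ q → + 2 * ((u + w) - q) , + 2 * q , Z)
           (trans (cong half (half-rotated-difference u w)) (half-2* w)) ⟩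
    (+ 2 * ((u + w) - w) , + 2 * w , Z)
      ≡⟨ cong (λ u′ → + 2 * u′ , + 2 * w , Z) (cancel u w) ⟩
    (+ 2 * u , + 2 * w , Z)
      ≡⟨ cong₂ (λ X′ Y′ → X′ , Y′ , Z) (even⇒≡2*half X oX) (even⇒≡2*half Y oY) ⟨
    (X , Y , Z) ∎
    where
    open ≡-Reasoning
    u w : ℤ
    u = half X
    w = half Y
    cancel : ∀ u w → (u + w) - w ≡ u
    cancel = solve-∀

  odd?-difference-of-odds : ∀ X Y → odd? X ≡ true → odd? Y ≡ true → odd? (Y - X) ≡ false
  odd?-difference-of-odds X Y oX oY = trans (odd?-+ Y (- X)) (cong₂ _xor_ oY (trans (odd?-neg X) oX))

  even-half-even⇒≡4*quarter : ∀ d → odd? d ≡ false → odd? (half d) ≡ false → d ≡ + 4 * half (half d)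
  even-half-even⇒≡4*quarter d even even′ =
    trans (even⇒≡2*half d even) (trans (cong (+ 2 *_) (even⇒≡2*half (half d) even′)) (regroup (half (half d))))
    where
    regroup : ∀ q → + 2 * (+ 2 * q) ≡ + 4 * q
    regroup = solve-∀

  rotate-unrotate : ∀ v → allOdd v ≡ true → congruentMod4? v ≡ true → rotate (unrotate v) ≡ v
  rotate-unrotate (X , Y , Z) odd congruent = begin
    rotate (unrotate (X , Y , Z))
      ≡⟨ cong₂ (λ s q → s - + 3 * q , s + q , Z) (half-2* (Y - q)) (half-2* q) ⟩
    ((Y - q) - + 3 * q , (Y - q) + q , Z)
      ≡⟨ cong₂ (λ X′ Y′ → X′ , Y′ , Z) X≡ (cancel Y q) ⟩
    (X , Y , Z) ∎
    where
    open ≡-Reasoning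
    q : ℤ
    q = half (half (Y - X))
    oX : odd? X ≡ true
    oX = proj₁ (allOdd⇒ X Y Z odd)
    oY : odd? Y ≡ true
    oY = proj₁ (proj₂ (allOdd⇒ X Y Z odd))
    Y-X≡4q : Y - X ≡ + 4 * q
    Y-X≡4q = even-half-even⇒≡4*quarter (Y - X) (odd?-difference-of-odds X Y oX oY)
      (trans (sym (Bool.not-involutive _)) (cong not congruent))
    cancel : ∀ Y q → (Y - q) + q ≡ Y
    cancel = solve-∀
    regroup : ∀ Y q → (Y - q) - + 3 * q ≡ Y - + 4 * q
    regroup = solve-∀
    recover : ∀ X Y → Y - (Y - X) ≡ X
    recover = solve-∀
    X≡ : (Y - q) - + 3 * q ≡ X
    X≡ = trans (regroup Y q) (trans (cong (_-_ Y) (sym Y-X≡4q)) (recover X Y))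

  allOdd-unrotate : ∀ v → allOdd (unrotate v) ≡ false
  allOdd-unrotate (X , Y , Z) rewrite odd?-2* (Y - half (half (Y - X))) = refl

  evens-unrotate : ∀ v → let X′ , Y′ , _ = unrotate v in odd? X′ ≡ false × odd? Y′ ≡ false
  evens-unrotate (X , Y , Z) = odd?-2* (Y - half (half (Y - X))) , odd?-2* (half (half (Y - X)))

  flipY : ℤ³ → ℤ³
  flipY (X , Y , Z) = (X , - Y , Z)

  flipY-involutive : ∀ v → flipY (flipY v) ≡ v
  flipY-involutive (X , Y , Z) = cong (λ Y′ → X , Y′ , Z) (ℤ.neg-involutive Y)

  allOdd-flipY : ∀ v → allOdd (flipY v) ≡ allOdd v
  allOdd-flipY (X , Y , Z) = cong (λ r → odd? X ∧ r ∧ odd? Z) (odd?-neg Y)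

  congruentMod4?-flipY : ∀ v → allOdd v ≡ true → congruentMod4? (flipY v) ≡ not (congruentMod4? v)
  congruentMod4?-flipY (X , Y , Z) odd = cong not (begin
    odd? (half (- Y - X))              ≡⟨ cong (odd? ∘ half) -Y-X≡ ⟩
    odd? (half (+ 2 * - (X + k)))      ≡⟨ cong odd? (half-2* (- (X + k))) ⟩
    odd? (- (X + k))                   ≡⟨ odd?-neg (X + k) ⟩
    odd? (X + k)                       ≡⟨ odd?-+ X k ⟩
    odd? X xor odd? k                  ≡⟨ cong (_xor odd? k) oX ⟩
    not (odd? k)                       ∎)
    where
    open ≡-Reasoning
    k : ℤ
    k = half (Y - X)
    oX : odd? X ≡ true
    oX = proj₁ (allOdd⇒ X Y Z odd)
    oY : odd? Y ≡ true
    oY = proj₁ (proj₂ (allOdd⇒ X Y Z odd))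
    regroup : ∀ X Y → - Y - X ≡ - (Y - X) - + 2 * X
    regroup = solve-∀
    regroup′ : ∀ X k → - (+ 2 * k) - + 2 * X ≡ + 2 * - (X + k)
    regroup′ = solve-∀
    Y-X≡2k : Y - X ≡ + 2 * k
    Y-X≡2k = even⇒≡2*half (Y - X) (odd?-difference-of-odds X Y oX oY)
    -Y-X≡ : - Y - X ≡ + 2 * - (X + k)
    -Y-X≡ = trans (regroup X Y) (trans (cong (λ d → - d - + 2 * X) Y-X≡2k) (regroup′ X k))

  -- The forms a x² + 3a y² + 2b z² and a x(x−1) + 3a y(y−1) + 2b z(z−1)

  module _ (A B : ℤ) where

    Q : ℤ³ → ℤ
    Q = form sq A (+ 3 * A) (+ 2 * B)

    T : ℤ³ → ℤ
    T = form twoTri A (+ 3 * A) (+ 2 * B)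

    target : ℤ → ℤ
    target n = + 8 * n + + 4 * A + + 2 * B

    Q-rotate : ∀ u w Z → Q (u - + 3 * w , u + w , Z) ≡ Q (+ 2 * u , + 2 * w , Z)
    Q-rotate = certificate A B
      where
      certificate : ∀ A B u w Z →
        A * ((u - + 3 * w) * (u - + 3 * w)) + + 3 * A * ((u + w) * (u + w)) + + 2 * B * (Z * Z)
        ≡ A * ((+ 2 * u) * (+ 2 * u)) + + 3 * A * ((+ 2 * w) * (+ 2 * w)) + + 2 * B * (Z * Z)
      certificate = solve-∀

    Q-rotate-even : ∀ X Y Z → odd? X ≡ false → odd? Y ≡ false → Q (rotate (X , Y , Z)) ≡ Q (X , Y , Z)
    Q-rotate-even X Y Z oX oY = trans (Q-rotate (half X) (half Y) Z)
      (sym (cong₂ (λ X′ Y′ → Q (X′ , Y′ , Z)) (even⇒≡2*half X oX) (even⇒≡2*half Y oY)))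

    Q-negate : ∀ X Y Z → Q (X , - Y , Z) ≡ Q (X , Y , Z)
    Q-negate = certificate A B
      where
      certificate : ∀ A B X Y Z →
        A * (X * X) + + 3 * A * (- Y * - Y) + + 2 * B * (Z * Z)
        ≡ A * (X * X) + + 3 * A * (Y * Y) + + 2 * B * (Z * Z)
      certificate = solve-∀

    target-Q-2*-1 : ∀ n x y z →
      target n - Q (+ 2 * x - + 1 , + 2 * y - + 1 , + 2 * z - + 1) ≡ + 4 * (+ 2 * n - T (x , y , z))
    target-Q-2*-1 = certificate A B
      where
      certificate : ∀ A B n x y z →
        (+ 8 * n + + 4 * A + + 2 * B)
          - (A * ((+ 2 * x - + 1) * (+ 2 * x - + 1)) + + 3 * A * ((+ 2 * y - + 1) * (+ 2 * y - + 1))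
             + + 2 * B * ((+ 2 * z - + 1) * (+ 2 * z - + 1)))
        ≡ + 4 * (+ 2 * n - (A * (x * (x - + 1)) + + 3 * A * (y * (y - + 1)) + + 2 * B * (z * (z - + 1))))
      certificate = solve-∀

    module _ (A-odd : odd? A ≡ true) (B-odd : odd? B ≡ true) (n : ℤ) where

      -- In each excluded parity pattern, target n − Q v is an odd number times 1, 2 or 4.

      odd-even-nonsolution : ∀ X Y Z → odd? X ≡ true → odd? Y ≡ false → target n - Q (X , Y , Z) ≢ + 0
      odd-even-nonsolution X Y Z oX oY rewrite odd⇒≡2*half+1 X oX | even⇒≡2*half Y oY =
        odd+2*≢0 {A} _ A-odd ∘ trans (sym (certificate A B n (half X) (half Y) Z))
        where
        certificate : ∀ A B n p q Z →
          (+ 8 * n + + 4 * A + + 2 * B)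
            - (A * ((+ 2 * p + + 1) * (+ 2 * p + + 1)) + + 3 * A * ((+ 2 * q) * (+ 2 * q)) + + 2 * B * (Z * Z))
          ≡ A + + 2 * (+ 4 * n + A + B - + 2 * A * (p * p + p) - + 6 * A * (q * q) - B * (Z * Z))
        certificate = solve-∀

      even-odd-nonsolution : ∀ X Y Z → odd? X ≡ false → odd? Y ≡ true → target n - Q (X , Y , Z) ≢ + 0
      even-odd-nonsolution X Y Z oX oY rewrite even⇒≡2*half X oX | odd⇒≡2*half+1 Y oY =
        odd+2*≢0 {A} _ A-odd ∘ trans (sym (certificate A B n (half X) (half Y) Z))
        where
        certificate : ∀ A B n p q Z →
          (+ 8 * n + + 4 * A + + 2 * B)
            - (A * ((+ 2 * p) * (+ 2 * p)) + + 3 * A * ((+ 2 * q + + 1) * (+ 2 * q + + 1)) + + 2 * B * (Z * Z))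
          ≡ A + + 2 * (+ 4 * n + B - + 2 * A * (p * p) - + 6 * A * (q * q + q) - B * (Z * Z))
        certificate = solve-∀

      Z-even-nonsolution : ∀ X Y Z → odd? X ≡ odd? Y → odd? Z ≡ false → target n - Q (X , Y , Z) ≢ + 0
      Z-even-nonsolution X Y Z oX≡oY oZ = subst (λ v → target n - Q v ≢ + 0) (sym shape)
        (odd+2*≢0 {B} _ B-odd ∘ ℤ.*-cancelˡ-≡ (+ 2) _ (+ 0)
          ∘ trans (sym (certificate A B n (half X) (half Y) (bit (odd? X)) (half Z))))
        where
        shape : (X , Y , Z) ≡ (+ 2 * half X + bit (odd? X) , + 2 * half Y + bit (odd? X) , + 2 * half Z)
        shape = cong₂ _,_ (half-odd?-decomposition X) (cong₂ _,_
          (trans (half-odd?-decomposition Y) (cong (λ r → + 2 * half Y + bit r) (sym oX≡oY))) (even⇒≡2*half Z oZ))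
        certificate : ∀ A B n p q r s →
          (+ 8 * n + + 4 * A + + 2 * B)
            - (A * ((+ 2 * p + r) * (+ 2 * p + r)) + + 3 * A * ((+ 2 * q + r) * (+ 2 * q + r))
               + + 2 * B * ((+ 2 * s) * (+ 2 * s)))
          ≡ + 2 * (B + + 2 * (+ 2 * n + A - A * (r * r)
                              - A * (p * p + p * r + + 3 * (q * q) + + 3 * (q * r)) - + 2 * B * (s * s)))
        certificate = solve-∀

      halves-even-nonsolution : ∀ X Y Z → odd? X ≡ false → odd? Y ≡ false → odd? Z ≡ true →
        odd? (half X + half Y) ≡ false → target n - Q (X , Y , Z) ≢ + 0
      halves-even-nonsolution X Y Z oX oY oZ oXY = subst (λ v → target n - Q v ≢ + 0) (sym shape)
        (odd+2*≢0 {A} _ A-odd ∘ ℤ.*-cancelˡ-≡ (+ 4) _ (+ 0)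
          ∘ trans (sym (certificate A B n (half X) k (half Z))))
        where
        k : ℤ
        k = half (half X + half Y)
        cancel : ∀ u w → (u + w) - u ≡ w
        cancel = solve-∀
        half-Y≡ : half Y ≡ + 2 * k - half X
        half-Y≡ = trans (sym (cancel (half X) (half Y))) (cong (_- half X) (even⇒≡2*half (half X + half Y) oXY))
        shape : (X , Y , Z) ≡ (+ 2 * half X , + 2 * (+ 2 * k - half X) , + 2 * half Z + + 1)
        shape = cong₂ _,_ (even⇒≡2*half X oX)
          (cong₂ _,_ (trans (even⇒≡2*half Y oY) (cong (+ 2 *_) half-Y≡)) (odd⇒≡2*half+1 Z oZ))
        certificate : ∀ A B n u k s →
          (+ 8 * n + + 4 * A + + 2 * B)
            - (A * ((+ 2 * u) * (+ 2 * u)) + + 3 * A * ((+ 2 * (+ 2 * k - u)) * (+ 2 * (+ 2 * k - u)))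
               + + 2 * B * ((+ 2 * s + + 1) * (+ 2 * s + + 1)))
          ≡ + 4 * (A + + 2 * (n - + 2 * A * (u * u - + 3 * (k * u) + + 3 * (k * k)) - B * (s * s + s)))
        certificate = solve-∀

      non-odd-solution-shape : ∀ X Y Z → target n - Q (X , Y , Z) ≡ + 0 → allOdd (X , Y , Z) ≡ false →
        odd? X ≡ false × odd? Y ≡ false × odd? Z ≡ true × odd? (half X + half Y) ≡ true
      non-odd-solution-shape X Y Z solution notAllOdd
        with odd? X in oX | odd? Y in oY | odd? Z in oZ | odd? (half X + half Y) in oXY
      ... | true  | true  | true  | _     = case notAllOdd of λ ()
      ... | true  | false | _     | _     = ⊥-elim (odd-even-nonsolution X Y Z oX oY solution)
      ... | false | true  | _     | _     = ⊥-elim (even-odd-nonsolution X Y Z oX oY solution)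
      ... | true  | true  | false | _     = ⊥-elim (Z-even-nonsolution X Y Z (trans oX (sym oY)) oZ solution)
      ... | false | false | false | _     = ⊥-elim (Z-even-nonsolution X Y Z (trans oX (sym oY)) oZ solution)
      ... | false | false | true  | false = ⊥-elim (halves-even-nonsolution X Y Z oX oY oZ oXY solution)
      ... | false | false | true  | true  = refl , refl , refl , refl

  module Counting (a b n : ℕ) (a-odd : odd? (+ a) ≡ true) (b-odd : odd? (+ b) ≡ true) where

    M : ℕ
    M = 8 ℕ.* n ℕ.+ 4 ℕ.* a ℕ.+ 2 ℕ.* b

    m : ℤ
    m = target (+ a) (+ b) (+ n)

    sol solT solOdd solEven solOdd₀ solOdd₂ : ℤ³ → ℕ
    sol v     = δ (m - Q (+ a) (+ b) v)
    solT v    = δ (+ 2 * + n - T (+ a) (+ b) v)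
    solOdd    = restrict allOdd sol
    solEven   = restrict (not ∘ allOdd) sol
    solOdd₀   = restrict congruentMod4? solOdd
    solOdd₂   = restrict (not ∘ congruentMod4?) solOdd

    instance
      a≢0 : NonZero a
      a≢0 = odd-nonZero a a-odd
      b≢0 : NonZero b
      b≢0 = odd-nonZero b b-odd
      3a≢0 : NonZero (3 ℕ.* a)
      3a≢0 = ℕ.m*n≢0 3 a
      2b≢0 : NonZero (2 ℕ.* b)
      2b≢0 = ℕ.m*n≢0 2 b

    form-coefficients : ∀ f v →
      form f (+ a) (+ 3 * + a) (+ 2 * + b) v ≡ form f (+ a) (+ (3 ℕ.* a)) (+ (2 ℕ.* b)) v
    form-coefficients f v = cong₂ (λ c d → form f (+ a) c d v) (sym (ℤ.pos-* 3 a)) (sym (ℤ.pos-* 2 b))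

    m≡M : m ≡ + M
    m≡M = begin
      + 8 * + n + + 4 * + a + + 2 * + b
        ≡⟨ cong₂ _+_ (cong₂ _+_ (ℤ.pos-* 8 n) (ℤ.pos-* 4 a)) (ℤ.pos-* 2 b) ⟨
      + (8 ℕ.* n) + + (4 ℕ.* a) + + (2 ℕ.* b)
        ≡⟨ cong (_+ + (2 ℕ.* b)) (ℤ.pos-+ (8 ℕ.* n) (4 ℕ.* a)) ⟨
      + (8 ℕ.* n ℕ.+ 4 ℕ.* a) + + (2 ℕ.* b)
        ≡⟨ ℤ.pos-+ (8 ℕ.* n ℕ.+ 4 ℕ.* a) (2 ℕ.* b) ⟨
      + M ∎
      where open ≡-Reasoning

    N≡Σsol : N (a ∷ 3 ℕ.* a ∷ 2 ℕ.* b ∷ []) M ≡ sum (map sol (box M))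
    N≡Σsol = trans (cnt-box sq M a (3 ℕ.* a) (2 ℕ.* b) (+ M)) (cong sum (map-cong entry (box M)))
      where
      entry : ∀ v → δ (+ M - form sq (+ a) (+ (3 ℕ.* a)) (+ (2 ℕ.* b)) v) ≡ sol v
      entry v = cong δ (cong₂ _-_ (sym m≡M) (sym (form-coefficients sq v)))

    t≡ΣsolT : t (a ∷ 3 ℕ.* a ∷ 2 ℕ.* b ∷ []) n ≡ sum (map solT (box (suc n)))
    t≡ΣsolT = trans (cnt-box twoTri (suc n) a (3 ℕ.* a) (2 ℕ.* b) (+ (2 ℕ.* n)))
      (cong sum (map-cong entry (box (suc n))))
      where
      entry : ∀ v → δ (+ (2 ℕ.* n) - form twoTri (+ a) (+ (3 ℕ.* a)) (+ (2 ℕ.* b)) v) ≡ solT v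
      entry v = cong δ (cong₂ _-_ (ℤ.pos-* 2 n) (sym (form-coefficients twoTri v)))

    sol-support : ∀ v → NonZero (sol v) → v ∈ box M
    sol-support v nz = solution∈box sq≡∣∣² ∣∣²-bound a (3 ℕ.* a) (2 ℕ.* b) v
      (trans (sym (form-coefficients sq v)) (trans (sym (ℤ.i-j≡0⇒i≡j m _ (δ-nonZero _ nz))) m≡M))

    solT-support : ∀ v → NonZero (solT v) → v ∈ box (suc n)
    solT-support v nz = solution∈box twoTri≡twoTriℕ twoTriℕ-bound a (3 ℕ.* a) (2 ℕ.* b) v
      (trans (sym (form-coefficients twoTri v))
        (trans (sym (ℤ.i-j≡0⇒i≡j _ _ (δ-nonZero _ nz))) (sym (ℤ.pos-* 2 n))))

    solOdd-support : ∀ v → NonZero (solOdd v) → v ∈ box M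
    solOdd-support = restrict-support allOdd sol-support

    solOdd-class : ∀ P v → NonZero (restrict P solOdd v) → P v ≡ true × allOdd v ≡ true
    solOdd-class P v nz = proj₁ (restrict-nonZero P solOdd v nz) ,
      proj₁ (restrict-nonZero allOdd sol v (proj₂ (restrict-nonZero P solOdd v nz)))

    solOdd-toOdd : ∀ v → solOdd (toOdd v) ≡ solT v
    solOdd-toOdd v@(x , y , z) = begin
      solOdd (toOdd v)                         ≡⟨ restrict-true allOdd sol (toOdd v) (allOdd-toOdd v) ⟩
      sol (toOdd v)                            ≡⟨ cong δ (target-Q-2*-1 (+ a) (+ b) (+ n) x y z) ⟩
      δ (+ 4 * (+ 2 * + n - T (+ a) (+ b) v))  ≡⟨ δ-4* _ ⟩
      solT v                                   ∎
      where open ≡-Reasoning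

    ΣsolT≡ΣsolOdd : sum (map solT (box (suc n))) ≡ sum (map solOdd (box M))
    ΣsolT≡ΣsolOdd = sum-reindex solT solOdd toOdd fromOdd (box-unique (suc n)) (box-unique M)
      solT-support solOdd-support (λ v _ → fromOdd-toOdd v , solOdd-toOdd v) inverse
      where
      inverse : ∀ v → NonZero (solOdd v) → toOdd (fromOdd v) ≡ v × solT (fromOdd v) ≡ solOdd v
      inverse v nz = let odd = proj₁ (restrict-nonZero allOdd sol v nz) in
        toOdd-fromOdd v odd , trans (sym (solOdd-toOdd (fromOdd v))) (cong solOdd (toOdd-fromOdd v odd))

    sol-cong : ∀ v v′ → Q (+ a) (+ b) v ≡ Q (+ a) (+ b) v′ → sol v ≡ sol v′
    sol-cong _ _ = cong (λ q → δ (m - q))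

    rotate-solEven : ∀ v → NonZero (solEven v) → unrotate (rotate v) ≡ v × solOdd₀ (rotate v) ≡ solEven v
    rotate-solEven v@(X , Y , Z) nz with restrict-nonZero (not ∘ allOdd) sol v nz
    ... | notOdd , nz′
      with non-odd-solution-shape (+ a) (+ b) a-odd b-odd (+ n) X Y Z (δ-nonZero _ nz′) (not≡true⇒≡false notOdd)
    ... | oX , oY , oZ , oXY with rotate-class X Y Z oZ oXY
    ... | odd , congruent =
      unrotate-rotate X Y Z oX oY , (begin
        solOdd₀ (rotate v)  ≡⟨ restrict-true congruentMod4? solOdd (rotate v) congruent ⟩
        solOdd (rotate v)   ≡⟨ restrict-true allOdd sol (rotate v) odd ⟩
        sol (rotate v)      ≡⟨ sol-cong (rotate v) v (Q-rotate-even (+ a) (+ b) X Y Z oX oY) ⟩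
        sol v               ≡⟨ restrict-true (not ∘ allOdd) sol v notOdd ⟨
        solEven v           ∎)
      where open ≡-Reasoning

    unrotate-solOdd₀ : ∀ v → NonZero (solOdd₀ v) →
      rotate (unrotate v) ≡ v × solEven (unrotate v) ≡ solOdd₀ v
    unrotate-solOdd₀ v@(X , Y , Z) nz with congruent , odd ← solOdd-class congruentMod4? v nz =
      rotate-unrotate v odd congruent , (begin
        solEven (unrotate v)       ≡⟨ restrict-true (not ∘ allOdd) sol (unrotate v) notOdd ⟩
        sol (unrotate v)           ≡⟨ sol-cong (rotate (unrotate v)) (unrotate v) Q-rotate-unrotate ⟨
        sol (rotate (unrotate v))  ≡⟨ cong sol (rotate-unrotate v odd congruent) ⟩
        sol v                      ≡⟨ restrict-true allOdd sol v odd ⟨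
        solOdd v                   ≡⟨ restrict-true congruentMod4? solOdd v congruent ⟨
        solOdd₀ v                  ∎)
      where
      open ≡-Reasoning
      q : ℤ
      q = half (half (Y - X))
      notOdd : not (allOdd (unrotate v)) ≡ true
      notOdd = cong not (allOdd-unrotate v)
      Q-rotate-unrotate : Q (+ a) (+ b) (rotate (unrotate v)) ≡ Q (+ a) (+ b) (unrotate v)
      Q-rotate-unrotate = Q-rotate-even (+ a) (+ b) (+ 2 * (Y - q)) (+ 2 * q) Z
        (proj₁ (evens-unrotate v)) (proj₂ (evens-unrotate v))

    ΣsolEven≡ΣsolOdd₀ : sum (map solEven (box M)) ≡ sum (map solOdd₀ (box M))
    ΣsolEven≡ΣsolOdd₀ = sum-reindex solEven solOdd₀ rotate unrotate (box-unique M) (box-unique M)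
      (restrict-support (not ∘ allOdd) sol-support) (restrict-support congruentMod4? solOdd-support)
      rotate-solEven unrotate-solOdd₀

    solOdd-flipY : ∀ v → solOdd (flipY v) ≡ solOdd v
    solOdd-flipY v@(X , Y , Z) = restrict-cong allOdd sol (flipY v) allOdd sol v
      (allOdd-flipY v) (sol-cong (flipY v) v (Q-negate (+ a) (+ b) X Y Z))

    flipY-solOdd₂ : ∀ v → NonZero (solOdd₂ v) → flipY (flipY v) ≡ v × solOdd₀ (flipY v) ≡ solOdd₂ v
    flipY-solOdd₂ v nz = flipY-involutive v ,
      restrict-cong congruentMod4? solOdd (flipY v) (not ∘ congruentMod4?) solOdd v
        (congruentMod4?-flipY v (proj₂ (solOdd-class (not ∘ congruentMod4?) v nz))) (solOdd-flipY v)

    flipY-solOdd₀ : ∀ v → NonZero (solOdd₀ v) → flipY (flipY v) ≡ v × solOdd₂ (flipY v) ≡ solOdd₀ v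
    flipY-solOdd₀ v nz = flipY-involutive v ,
      restrict-cong (not ∘ congruentMod4?) solOdd (flipY v) congruentMod4? solOdd v
        (trans (cong not (congruentMod4?-flipY v (proj₂ (solOdd-class congruentMod4? v nz))))
               (Bool.not-involutive _))
        (solOdd-flipY v)

    ΣsolOdd₂≡ΣsolOdd₀ : sum (map solOdd₂ (box M)) ≡ sum (map solOdd₀ (box M))
    ΣsolOdd₂≡ΣsolOdd₀ = sum-reindex solOdd₂ solOdd₀ flipY flipY (box-unique M) (box-unique M)
      (restrict-support (not ∘ congruentMod4?) solOdd-support) (restrict-support congruentMod4? solOdd-support)
      flipY-solOdd₂ flipY-solOdd₀

    3t≡2N : 3 ℕ.* t (a ∷ 3 ℕ.* a ∷ 2 ℕ.* b ∷ []) n ≡ 2 ℕ.* N (a ∷ 3 ℕ.* a ∷ 2 ℕ.* b ∷ []) M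
    3t≡2N = begin
      3 ℕ.* t (a ∷ 3 ℕ.* a ∷ 2 ℕ.* b ∷ []) n   ≡⟨ cong (3 ℕ.*_) t≡2S ⟩
      3 ℕ.* (S ℕ.+ S)                          ≡⟨ arithmetic S ⟩
      2 ℕ.* (S ℕ.+ S ℕ.+ S)                    ≡⟨ cong (2 ℕ.*_) N≡3S ⟨
      2 ℕ.* N (a ∷ 3 ℕ.* a ∷ 2 ℕ.* b ∷ []) M   ∎
      where
      open ≡-Reasoning
      Σ : (ℤ³ → ℕ) → ℕ
      Σ h = sum (map h (box M))
      S : ℕ
      S = Σ solOdd₀
      ΣsolOdd≡2S : Σ solOdd ≡ S ℕ.+ S
      ΣsolOdd≡2S = trans (sum-restrict congruentMod4? solOdd (box M)) (cong (S ℕ.+_) ΣsolOdd₂≡ΣsolOdd₀)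
      t≡2S : t (a ∷ 3 ℕ.* a ∷ 2 ℕ.* b ∷ []) n ≡ S ℕ.+ S
      t≡2S = trans t≡ΣsolT (trans ΣsolT≡ΣsolOdd ΣsolOdd≡2S)
      N≡3S : N (a ∷ 3 ℕ.* a ∷ 2 ℕ.* b ∷ []) M ≡ S ℕ.+ S ℕ.+ S
      N≡3S = trans N≡Σsol
        (trans (sum-restrict allOdd sol (box M)) (cong₂ ℕ._+_ ΣsolOdd≡2S ΣsolEven≡ΣsolOdd₀))
      arithmetic : ∀ s → 3 ℕ.* (s ℕ.+ s) ≡ 2 ℕ.* (s ℕ.+ s ℕ.+ s)
      arithmetic = ℕ-Solver.solve-∀

open import Data.Nat using (ℕ; _+_; _*_; _%_; _≥_)
open import Data.List using (_∷_; [])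
open import Relation.Binary.PropositionalEquality using (_≡_)
open Representations using (module Counting; %2≡1⇒odd?)

-- The identity holds for n = 0 as well.
theorem3p1 : (a b : ℕ) → a % 2 ≡ 1 → b % 2 ≡ 1 → (n : ℕ) → n ≥ 1 →
    3 * t (a ∷ 3 * a ∷ 2 * b ∷ []) n ≡ 2 * N (a ∷ 3 * a ∷ 2 * b ∷ []) (8 * n + 4 * a + 2 * b)
theorem3p1 a b a%2≡1 b%2≡1 n _ = Counting.3t≡2N a b n (%2≡1⇒odd? a a%2≡1) (%2≡1⇒odd? b b%2≡1)
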